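{- Every complete bipartite game graph has clique-width two and is strongly ergodic.
   Context: A game graph is a finite directed graph $G=(V,E)$ in which every node has out-degree at least $1$, with a partition $V=V_A\cup V_B$ into nodes of Alice and of Bob. It is complete bipartite if (bipartite) there is no edge between two nodes of $V_A$ and no edge between two nodes of $V_B$, and (complete) for every $u\in V_A$, $v\in V_B$ there is an edge $(u,v)\in E$, and for every $u\in V_B$, $v\in V_A$ there is an edge $(u,v)\in E$. Clique-width: the minimum number of labels needed to construct the directed graph using the operations (1) create a new node with label $i$; (2) disjoint union of two labeled graphs; (3) add an edge $(u,v)$ for every node $u$ with label $i$ and every node $v$ with label $j$; (4) rename label $i$ to label $j$. Ergodicity: an ergodic partition is a partition $(S_A,S_B)$ of $V$ such that (1) every $u\in S_A\cap V_A$ has an out-neighbor in $S_A$; (2) no edge goes from $S_A\cap V_B$ to $S_B$; (3) every $u\in S_B\cap V_B$ has an out-neighbor in $S_B$; (4) no edge goes from $S_B\cap V_A$ to $S_A$. It is trivial if $S_A=\emptyset$ or $S_B=\emptyset$. A graph is ergodic if it has no non-trivial ergodic partition, and strongly ergodic if every induced subgraph in which every node has out-degree at least $1$ is ergodic. -}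

module Defs where

open import Data.Nat using (ℕ; suc; _+_; _≤_)
open import Data.Fin using (Fin; splitAt; _≟_)
open import Data.Sum using (_⊎_; inj₁; inj₂)
open import Data.Product using (Σ; ∃; _×_; _,_)
open import Data.Bool using (Bool; true; false)
open import Data.Empty using (⊥)
open import Relation.Nullary using (¬_; yes; no)
open import Relation.Binary.PropositionalEquality using (_≡_; _≢_)
open import Function.Bundles using (_↔_; Inverse)

data Player : Set where
  Alice Bob : Player

IsGameGraph : {V : Set} → (V → V → Set) → Set
IsGameGraph {V} E = (u : V) → Σ V (λ v → E u v)

CompleteBipartite : {V : Set} → (V → Player) → (V → V → Set) → Set
CompleteBipartite {V} own E =
  ((u v : V) → own u ≡ own v → ¬ E u v) ×
  ((u v : V) → own u ≢ own v → E u v)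

-- Ergodic partitions.  S u ≡ true means u ∈ S_A, S u ≡ false means u ∈ S_B.

record ErgodicPartition {V : Set} (own : V → Player) (E : V → V → Set)
                        (S : V → Bool) : Set where
  field
    condA₁ : (u : V) → own u ≡ Alice → S u ≡ true →
             Σ V (λ v → E u v × S v ≡ true)
    condA₂ : (u v : V) → own u ≡ Bob → S u ≡ true → E u v → S v ≡ true
    condB₁ : (u : V) → own u ≡ Bob → S u ≡ false →
             Σ V (λ v → E u v × S v ≡ false)
    condB₂ : (u v : V) → own u ≡ Alice → S u ≡ false → E u v → S v ≡ false

NonTrivial : {V : Set} → (V → Bool) → Set
NonTrivial {V} S = Σ V (λ u → S u ≡ true) × Σ V (λ v → S v ≡ false)

Ergodic : {V : Set} → (V → Player) → (V → V → Set) → Set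
Ergodic {V} own E =
  ¬ Σ (V → Bool) (λ S → ErgodicPartition own E S × NonTrivial S)

Sub : {V : Set} → (V → Bool) → Set
Sub {V} W = Σ V (λ v → W v ≡ true)

subOwn : {V : Set} (W : V → Bool) → (V → Player) → Sub W → Player
subOwn W own (v , _) = own v

subE : {V : Set} (W : V → Bool) → (V → V → Set) → Sub W → Sub W → Set
subE W E (u , _) (v , _) = E u v

StronglyErgodic : {V : Set} → (V → Player) → (V → V → Set) → Set
StronglyErgodic {V} own E =
  (W : V → Bool) → IsGameGraph (subE W E) →
  Ergodic (subOwn W own) (subE W E)

data CWExpr (k : ℕ) : Set where
  node  : Fin k → CWExpr k
  _⊕_   : CWExpr k → CWExpr k → CWExpr k
  η     : Fin k → Fin k → CWExpr k → CWExpr k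
  ρ     : Fin k → Fin k → CWExpr k → CWExpr k

size : {k : ℕ} → CWExpr k → ℕ
size (node _)  = 1
size (e ⊕ f)   = size e + size f
size (η _ _ e) = size e
size (ρ _ _ e) = size e

label : {k : ℕ} (e : CWExpr k) → Fin (size e) → Fin k
label (node i) _ = i
label (e ⊕ f) x with splitAt (size e) x
... | inj₁ y = label e y
... | inj₂ z = label f z
label (η _ _ e) x = label e x
label (ρ i j e) x with label e x ≟ i
... | yes _ = j
... | no  _ = label e x

edge : {k : ℕ} (e : CWExpr k) → Fin (size e) → Fin (size e) → Set
edge (node _) _ _ = ⊥
edge (e ⊕ f) x y with splitAt (size e) x | splitAt (size e) y
... | inj₁ x′ | inj₁ y′ = edge e x′ y′
... | inj₂ x′ | inj₂ y′ = edge f x′ y′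
... | inj₁ _  | inj₂ _  = ⊥
... | inj₂ _  | inj₁ _  = ⊥
edge (η i j e) x y = edge e x y ⊎ (label e x ≡ i × label e y ≡ j)
edge (ρ _ _ e) x y = edge e x y

Generates : {k n : ℕ} → CWExpr k → (Fin n → Fin n → Set) → Set
Generates {k} {n} e E =
  Σ (Fin (size e) ↔ Fin n) (λ σ →
    (x y : Fin (size e)) →
      (edge e x y → E (Inverse.to σ x) (Inverse.to σ y)) ×
      (E (Inverse.to σ x) (Inverse.to σ y) → edge e x y))

HasCliqueWidth≤ : {n : ℕ} → ℕ → (Fin n → Fin n → Set) → Set
HasCliqueWidth≤ k E = Σ (CWExpr k) (λ e → Generates e E)

HasCliqueWidthTwo : {n : ℕ} → (Fin n → Fin n → Set) → Set
HasCliqueWidthTwo E = HasCliqueWidth≤ 2 E × ¬ HasCliqueWidth≤ 1 E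

-- Clique-width two: give every node the label of its owner and join the two
-- label classes by an edge operation in each direction; one label is too few,
-- since with a single label every edge forces a self-loop.
-- Strong ergodicity: induced subgraphs stay complete bipartite, and in a
-- non-trivial ergodic partition S_A contains a Bob node and S_B an Alice node
-- (an Alice node of S_A has an out-neighbour in S_A, which is Bob's, and
-- dually), but then the edge from that Bob node to that Alice node leaves S_A.
module Submission where

open import Defs
open import Data.Nat using (ℕ; _≤_; zero; suc; s≤s; z≤n)
open import Data.Fin using (Fin; zero; suc; cast; splitAt)
open import Data.Fin.Properties using (cast-involutive)
open import Data.Product using (Σ; _×_; _,_; proj₁; proj₂)
open import Data.Sum using (_⊎_; inj₁; inj₂)
open import Data.Bool using (Bool; true; false)
open import Data.Empty using (⊥-elim)
open import Relation.Nullary using (¬_)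
open import Relation.Binary.PropositionalEquality
  using (_≡_; _≢_; refl; sym; trans; cong; subst₂)
open import Function.Base using (_∘_; case_of_)
open import Function.Bundles using (_↔_; _⇔_; Inverse; Equivalence; mk↔ₛ′; mk⇔)
open import Function.Properties.Equivalence using ()
  renaming (trans to ⇔-trans; sym to ⇔-sym)

opponent : Player → Player
opponent Alice = Bob
opponent Bob   = Alice

≢⇒opponent : {p q : Player} → p ≢ q → q ≡ opponent p
≢⇒opponent {Alice} {Alice} p≢q = ⊥-elim (p≢q refl)
≢⇒opponent {Alice} {Bob}   _   = refl
≢⇒opponent {Bob}   {Alice} _   = refl
≢⇒opponent {Bob}   {Bob}   p≢q = ⊥-elim (p≢q refl)

playerLabel : Player → Fin 2
playerLabel Alice = zero
playerLabel Bob   = suc zero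

playerLabel-injective : {p q : Player} → playerLabel p ≡ playerLabel q → p ≡ q
playerLabel-injective {Alice} {Alice} _ = refl
playerLabel-injective {Bob}   {Bob}   _ = refl

module _ {V : Set} {own : V → Player} {E : V → V → Set}
         (cb : CompleteBipartite own E) where

  edge-owners-differ : {u v : V} → E u v → own u ≢ own v
  edge-owners-differ {u} {v} uv same = proj₁ cb u v same uv

  edge⇔owners-differ : {u v : V} → E u v ⇔ (own u ≢ own v)
  edge⇔owners-differ {u} {v} = mk⇔ edge-owners-differ (proj₂ cb u v)

  loopless : (u : V) → ¬ E u u
  loopless u = proj₁ cb u u refl

  edge-target-owner : {u v : V} → E u v → own v ≡ opponent (own u)
  edge-target-owner uv = ≢⇒opponent (edge-owners-differ uv)

  module _ {S : V → Bool} (P : ErgodicPartition own E S) where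
    open ErgodicPartition P

    S_A-has-Bob-node : {u : V} → S u ≡ true →
      Σ V (λ b → own b ≡ Bob × S b ≡ true)
    S_A-has-Bob-node {u} su with own u in ownU
    ... | Bob   = u , ownU , su
    ... | Alice with condA₁ u ownU su
    ...   | w , uw , sw = w , trans (edge-target-owner uw) (cong opponent ownU) , sw

    S_B-has-Alice-node : {u : V} → S u ≡ false →
      Σ V (λ a → own a ≡ Alice × S a ≡ false)
    S_B-has-Alice-node {u} su with own u in ownU
    ... | Alice = u , ownU , su
    ... | Bob with condB₁ u ownU su
    ...   | w , uw , sw = w , trans (edge-target-owner uw) (cong opponent ownU) , sw

  Bob→Alice-edge : {b a : V} → own b ≡ Bob → own a ≡ Alice → E b a
  Bob→Alice-edge {b} {a} ownB ownA = proj₂ cb b a λ eq →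
    case trans (sym ownB) (trans eq ownA) of λ ()

  completeBipartite⇒ergodic : Ergodic own E
  completeBipartite⇒ergodic (S , P , (u , su) , (v , sv))
    with S_A-has-Bob-node P su | S_B-has-Alice-node P sv
  ... | b , ownB , sb | a , ownA , sa
    with () ← trans (sym sa)
                    (ErgodicPartition.condA₂ P b a ownB sb (Bob→Alice-edge ownB ownA))

completeBipartite-induced : {V : Set} {own : V → Player} {E : V → V → Set} →
  (W : V → Bool) → CompleteBipartite own E →
  CompleteBipartite (subOwn W own) (subE W E)
completeBipartite-induced W (noEdge , edge) =
  (λ { (u , _) (v , _) → noEdge u v }) , (λ { (u , _) (v , _) → edge u v })

completeBipartite⇒stronglyErgodic : {V : Set} {own : V → Player} {E : V → V → Set} →
  CompleteBipartite own E → StronglyErgodic own E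
completeBipartite⇒stronglyErgodic cb W _ =
  completeBipartite⇒ergodic (completeBipartite-induced W cb)

edgeless : {k : ℕ} (m : ℕ) → (Fin (suc m) → Fin k) → CWExpr k
edgeless zero    c = node (c zero)
edgeless (suc m) c = node (c zero) ⊕ edgeless m (λ i → c (suc i))

size-edgeless : {k : ℕ} (m : ℕ) (c : Fin (suc m) → Fin k) →
  size (edgeless m c) ≡ suc m
size-edgeless zero    c = refl
size-edgeless (suc m) c = cong suc (size-edgeless m (λ i → c (suc i)))

label-edgeless : {k : ℕ} (m : ℕ) (c : Fin (suc m) → Fin k)
  (x : Fin (size (edgeless m c))) →
  label (edgeless m c) x ≡ c (cast (size-edgeless m c) x)
label-edgeless zero    c zero    = refl
label-edgeless (suc m) c zero    = refl
label-edgeless (suc m) c (suc x) = label-edgeless m (λ i → c (suc i)) x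

edgeless-no-edge : {k : ℕ} (m : ℕ) (c : Fin (suc m) → Fin k)
  (x y : Fin (size (edgeless m c))) →
  ¬ edge (edgeless m c) x y
edgeless-no-edge (suc m) c zero    zero    ()
edgeless-no-edge (suc m) c (suc x) (suc y) xy = edgeless-no-edge m (λ i → c (suc i)) x y xy

join₂ : CWExpr 2 → CWExpr 2
join₂ e = η zero (suc zero) (η (suc zero) zero e)

Fin2-≢ : {a b : Fin 2} → a ≢ b →
  (a ≡ suc zero × b ≡ zero) ⊎ (a ≡ zero × b ≡ suc zero)
Fin2-≢ {zero}     {zero}     a≢b = ⊥-elim (a≢b refl)
Fin2-≢ {zero}     {suc zero} _   = inj₂ (refl , refl)
Fin2-≢ {suc zero} {zero}     _   = inj₁ (refl , refl)
Fin2-≢ {suc zero} {suc zero} a≢b = ⊥-elim (a≢b refl)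

edge-join₂ : (e : CWExpr 2) → (∀ x y → ¬ edge e x y) →
  (x y : Fin (size e)) → edge (join₂ e) x y ⇔ (label e x ≢ label e y)
edge-join₂ e noEdge x y = mk⇔ differ join
  where
  differ : edge (join₂ e) x y → label e x ≢ label e y
  differ (inj₁ (inj₁ xy))        _  = noEdge x y xy
  differ (inj₁ (inj₂ (lx , ly))) eq with () ← trans (sym lx) (trans eq ly)
  differ (inj₂ (lx , ly))        eq with () ← trans (sym lx) (trans eq ly)

  join : label e x ≢ label e y → edge (join₂ e) x y
  join lx≢ly with Fin2-≢ lx≢ly
  ... | inj₁ labels = inj₁ (inj₂ labels)
  ... | inj₂ labels = inj₂ labels

twoLabelled⇒cliqueWidth≤2 : {m : ℕ} (E : Fin (suc m) → Fin (suc m) → Set)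
  (c : Fin (suc m) → Fin 2) →
  (∀ x y → E x y ⇔ (c x ≢ c y)) → HasCliqueWidth≤ 2 E
twoLabelled⇒cliqueWidth≤2 {m} E c E⇔differ = join₂ e , σ , generates
  where
  e : CWExpr 2
  e = edgeless m c

  eq : size e ≡ suc m
  eq = size-edgeless m c

  σ : Fin (size e) ↔ Fin (suc m)
  σ = mk↔ₛ′ (cast eq) (cast (sym eq))
            (cast-involutive eq (sym eq)) (cast-involutive (sym eq) eq)

  edge⇔E : (x y : Fin (size e)) → edge (join₂ e) x y ⇔ E (cast eq x) (cast eq y)
  edge⇔E x y = ⇔-trans
    (subst₂ (λ a b → edge (join₂ e) x y ⇔ (a ≢ b))
            (label-edgeless m c x) (label-edgeless m c y)
            (edge-join₂ e (edgeless-no-edge m c) x y))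
    (⇔-sym (E⇔differ (cast eq x) (cast eq y)))

  generates : (x y : Fin (size e)) →
    (edge (join₂ e) x y → E (cast eq x) (cast eq y)) ×
    (E (cast eq x) (cast eq y) → edge (join₂ e) x y)
  generates x y = Equivalence.to (edge⇔E x y) , Equivalence.from (edge⇔E x y)

oneLabel-edge⇒loop : (e : CWExpr 1) (x y : Fin (size e)) → edge e x y → edge e x x
oneLabel-edge⇒loop (e ⊕ f) x y xy with splitAt (size e) x | splitAt (size e) y
... | inj₁ x′ | inj₁ y′ = oneLabel-edge⇒loop e x′ y′ xy
... | inj₂ x′ | inj₂ y′ = oneLabel-edge⇒loop f x′ y′ xy
oneLabel-edge⇒loop (η _ _ e)       x y (inj₁ xy)       =
  inj₁ (oneLabel-edge⇒loop e x y xy)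
oneLabel-edge⇒loop (η zero zero e) x y (inj₂ (lx , _)) = inj₂ (lx , lx)
oneLabel-edge⇒loop (ρ _ _ e)       x y xy              = oneLabel-edge⇒loop e x y xy

loopless-edge⇒¬cliqueWidth≤1 : {n : ℕ} (E : Fin n → Fin n → Set) →
  (∀ u → ¬ E u u) → {u v : Fin n} → E u v → ¬ HasCliqueWidth≤ 1 E
loopless-edge⇒¬cliqueWidth≤1 E loopless {u} {v} uv (e , σ , generates) =
  loopless u (subst₂ E (strictlyInverseˡ u) (strictlyInverseˡ u)
                      (proj₁ (generates x x) xx))
  where
  open Inverse σ

  x y : Fin (size e)
  x = from u
  y = from v

  xx : edge e x x
  xx = oneLabel-edge⇒loop e x y
         (proj₂ (generates x y)
                (subst₂ E (sym (strictlyInverseˡ u)) (sym (strictlyInverseˡ v)) uv))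

completeBipartite⇒cliqueWidthTwo : {m : ℕ} {own : Fin (suc m) → Player}
  {E : Fin (suc m) → Fin (suc m) → Set} →
  IsGameGraph E → CompleteBipartite own E → HasCliqueWidthTwo E
completeBipartite⇒cliqueWidthTwo {own = own} {E} gg cb =
  twoLabelled⇒cliqueWidth≤2 E (playerLabel ∘ own)
    (λ _ _ → ⇔-trans (edge⇔owners-differ cb) ownersDiffer⇔labelsDiffer) ,
  loopless-edge⇒¬cliqueWidth≤1 E (loopless cb) (proj₂ (gg zero))
  where
  ownersDiffer⇔labelsDiffer : {p q : Player} → (p ≢ q) ⇔ (playerLabel p ≢ playerLabel q)
  ownersDiffer⇔labelsDiffer =
    mk⇔ (λ p≢q → p≢q ∘ playerLabel-injective) (λ lp≢lq → lp≢lq ∘ cong playerLabel)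

lemma17 : (n : ℕ) → 1 ≤ n → (own : Fin n → Player) → (E : Fin n → Fin n → Set) →
          IsGameGraph E → CompleteBipartite own E →
          HasCliqueWidthTwo E × StronglyErgodic own E
lemma17 (suc m) (s≤s z≤n) own E gg cb =
  completeBipartite⇒cliqueWidthTwo gg cb , completeBipartite⇒stronglyErgodic cb
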